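{- Let $G$ be a simple graph with base vertex $\ast$, and let $\Omega G$ be its loop graph with base vertex $\ast$ (defined in the context). For every $n\ge1$ there is an isomorphism of groups $A_n(\Omega G,\ast)\xrightarrow{\cong}A_{n+1}(G,\ast)$, natural with respect to based graph homomorphisms $\psi:(G,\ast_G)\to(H,\ast_H)$ (i.e. compatible with the maps induced by $\Omega\psi$ and $\psi$). Furthermore, there is a bijection $A_0(\Omega G,\ast)\to A_1(G,\ast)$.
   Context: Graphs are simple and undirected; a graph homomorphism (graph map) maps adjacent vertices to equal or adjacent vertices; a based map sends base vertex to base vertex. ${\bf I}_m$ ($m\in\mathbb N=\{0,1,2,\dots\}$) is the path graph with vertices $0,\dots,m$ and edges $\{i-1,i\}$; products are Cartesian products of graphs ($(u_1,u_2)\sim(v_1,v_2)$ iff equal in one coordinate and adjacent in the other). ${\bf I}^n_m$ is the $n$-fold product, $\partial{\bf I}^n_m$ the vertices having some coordinate $0$ or $m$. For a based graph $(\Gamma,v_0)$ and $n\ge1$, $A_n(\Gamma,v_0)$ is the group of classes of graph maps $f:{\bf I}^n_m\to\Gamma$ (any $m$) with $f(\partial{\bf I}^n_m)=v_0$; maps are extended to larger heights by the value $v_0$; $f,g$ of common height $m$ are equivalent iff there is a graph map $H:{\bf I}^n_m\times{\bf I}_l\to\Gamma$ with $H(\cdot,0)=f$, $H(\cdot,l)=g$ and $H(x,t)=v_0$ for all $x\in\partial{\bf I}^n_m$. The product of the classes of $f,g$ of height $m$ is the class of $h$ on ${\bf I}^n_{2m}$ with $h(i_1,\dots,i_n)=f(i_1,\dots,i_n)$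 if all $i_j\le m$, $h=g(i_1-m,i_2,\dots,i_n)$ if $i_1>m$ and $i_j\le m$ for $j>1$, and $h=v_0$ otherwise. $A_0(\Gamma,v_0)$ is the pointed set of connected components of $\Gamma$. A based map $\psi$ induces $\psi_\#:[f]\mapsto[\psi\circ f]$. Path graph $PG$: vertices are the graph maps $\varphi:{\bf I}_m\to G$ ($m\in\mathbb N$) with $\varphi(0)=\ast$. For vertices $\varphi_0:{\bf I}_m\to G$, $\varphi_1:{\bf I}_{m'}\to G$ with $m\le m'$, let $\varphi_0':{\bf I}_{m'}\to G$ be $\varphi_0'(y)=\varphi_0(y)$ for $y\le m$ and $\varphi_0'(y)=\varphi_0(m)$ otherwise; $\{\varphi_0,\varphi_1\}$ is an edge iff there is a graph map $\Phi:{\bf I}_{m'}\times{\bf I}_1\to G$ with $\Phi(\cdot,0)=\varphi_0'$ and $\Phi(\cdot,1)=\varphi_1$. Let $p:PG\to G$, $p(\varphi)=\varphi(m)$ for $\varphi:{\bf I}_m\to G$. The loop graph $\Omega G$ is the induced subgraph of $PG$ on $p^{ -1}(\ast)$, with base vertex $\ast$ the map ${\bf I}_0\to G$ sending the unique vertex to $\ast$. For a based graph map $\psi:(G,\ast)\to(H,\ast)$, $\Omega\psi:\Omega G\to\Omega H$ is $\Omega\psi(\varphi)=\psi\circ\varphi$. -}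

module Defs where

open import Data.Nat using (ℕ; zero; suc; _+_; _∸_; _≤_; _<_; _≤?_; _<?_; _⊔_; _⊓_)
open import Data.Fin using (Fin)
open import Data.Vec using (Vec; []; _∷_; lookup; _[_]≔_)
open import Data.Vec.Relation.Unary.All using (All; all?)
open import Data.Vec.Relation.Unary.Any using (Any)
open import Data.Product using (Σ; _×_; _,_; proj₁; proj₂)
open import Data.Sum using (_⊎_; inj₁; inj₂)
open import Data.Bool using (if_then_else_; _∧_)
open import Relation.Nullary using (¬_; does)
open import Relation.Binary.PropositionalEquality
  using (_≡_; refl; sym; trans; cong; subst; isEquivalence)
open import Relation.Binary.Structures using (IsEquivalence)

record Graph : Set₁ where
  field
    V     : Set
    E     : V → V → Set
    E-sym : ∀ {u v} → E u v → E v u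
    E-irr : ∀ {v} → ¬ E v v

open Graph public

EqAdj : (G : Graph) → V G → V G → Set
EqAdj G u v = u ≡ v ⊎ E G u v

record GHom (G H : Graph) : Set where
  field
    fun : V G → V H
    pres : ∀ {u v} → E G u v → EqAdj H (fun u) (fun v)

open GHom public

GHom-eqadj : ∀ {G H} (ψ : GHom G H) {u v : V G} →
             EqAdj G u v → EqAdj H (fun ψ u) (fun ψ v)
GHom-eqadj ψ (inj₁ e) = inj₁ (cong (fun ψ) e)
GHom-eqadj ψ (inj₂ a) = pres ψ a

record BasedHom (G : Graph) (bG : V G) (H : Graph) (bH : V H) : Set where
  field
    hom   : GHom G H
    based : fun hom bG ≡ bH

open BasedHom public

-- Graphs presented by a vertex setoid (_≈_) and the relation
-- "equal or adjacent" (_≃_).  Needed because vertices of the loop graph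
-- are graph maps, whose equality is extensional.

record RGraph : Set₁ where
  field
    RV    : Set
    _≈_   : RV → RV → Set
    ≈-eq  : IsEquivalence _≈_
    _≃_   : RV → RV → Set

open RGraph public

toR : Graph → RGraph
toR G = record { RV = V G ; _≈_ = _≡_ ; ≈-eq = isEquivalence ; _≃_ = EqAdj G }

record RHom (Γ Δ : RGraph) : Set where
  field
    rfun  : RV Γ → RV Δ
    rresp : ∀ {x y} → _≈_ Γ x y → _≈_ Δ (rfun x) (rfun y)
    rpres : ∀ {x y} → _≃_ Γ x y → _≃_ Δ (rfun x) (rfun y)

open RHom public

toRHom : ∀ {G H} → GHom G H → RHom (toR G) (toR H)
toRHom ψ = record { rfun = fun ψ ; rresp = cong (fun ψ) ; rpres = GHom-eqadj ψ }

PAdj : ℕ → ℕ → Set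
PAdj i j = suc i ≡ j ⊎ suc j ≡ i

Box : ∀ {n} → ℕ → Vec ℕ n → Set
Box m x = All (_≤ m) x

Bdry : ∀ {n} → ℕ → Vec ℕ n → Set
Bdry m x = Any (λ c → c ≡ 0 ⊎ c ≡ m) x

-- adjacency in the n-fold Cartesian product of path graphs:
-- differ in exactly one coordinate j, by one there
CAdj : ∀ {n} → Vec ℕ n → Vec ℕ n → Set
CAdj {n} x y = Σ (Fin n) λ j → (y ≡ x [ j ]≔ lookup y j) × PAdj (lookup x j) (lookup y j)

-- Representatives of elements of A_n(Γ, v₀): graph maps I^n_m → Γ
-- sending ∂I^n_m to v₀.

record LoopRep (Γ : RGraph) (v₀ : RV Γ) (n : ℕ) : Set where
  field
    height : ℕ
    map    : Vec ℕ n → RV Γ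
    mhom   : ∀ x y → Box height x → Box height y → CAdj x y → _≃_ Γ (map x) (map y)
    mbdry  : ∀ x → Box height x → Bdry height x → _≈_ Γ (map x) v₀

open LoopRep public

Raw : RGraph → ℕ → Set
Raw Γ n = ℕ × (Vec ℕ n → RV Γ)

raw : ∀ {Γ v₀ n} → LoopRep Γ v₀ n → Raw Γ n
raw r = height r , map r

ext : ∀ (Γ : RGraph) (v₀ : RV Γ) {n} → ℕ → (Vec ℕ n → RV Γ) → Vec ℕ n → RV Γ
ext Γ v₀ m f x = if does (all? (_≤? m) x) then f x else v₀

-- homotopy at common height N: graph map H : I^n_N × I_l → Γ
Homotopic : ∀ (Γ : RGraph) (v₀ : RV Γ) {n} → ℕ → (f g : Vec ℕ n → RV Γ) → Set
Homotopic Γ v₀ {n} N f g =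
  Σ ℕ λ l → Σ (Vec ℕ n → ℕ → RV Γ) λ H →
    (∀ x y t s → Box N x → Box N y → t ≤ l → s ≤ l →
       ((CAdj x y × t ≡ s) ⊎ (x ≡ y × PAdj t s)) → _≃_ Γ (H x t) (H y s))
  × (∀ x → Box N x → _≈_ Γ (H x 0) (f x))
  × (∀ x → Box N x → _≈_ Γ (H x l) (g x))
  × (∀ x t → Box N x → Bdry N x → t ≤ l → _≈_ Γ (H x t) v₀)

Equiv : ∀ (Γ : RGraph) (v₀ : RV Γ) {n} → Raw Γ n → Raw Γ n → Set
Equiv Γ v₀ (m , f) (m' , g) =
  Σ ℕ λ N → m ≤ N × m' ≤ N × Homotopic Γ v₀ N (ext Γ v₀ m f) (ext Γ v₀ m' g)

mult : ∀ (Γ : RGraph) (v₀ : RV Γ) {k} → Raw Γ (suc k) → Raw Γ (suc k) → Raw Γ (suc k)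
mult Γ v₀ (m , f) (m' , g) = (M + M) , h
  where
  M = m ⊔ m'
  F = ext Γ v₀ m f
  G = ext Γ v₀ m' g
  h : Vec ℕ _ → RV Γ
  h (c ∷ xs) =
    if does (all? (_≤? M) (c ∷ xs)) then F (c ∷ xs)
    else (if does (M <? c) ∧ does (all? (_≤? M) xs) then G ((c ∸ M) ∷ xs) else v₀)

post : ∀ {Γ Δ : RGraph} {v₀ : RV Γ} {w₀ : RV Δ} {n} (ψ : RHom Γ Δ) →
       _≈_ Δ (rfun ψ v₀) w₀ → LoopRep Γ v₀ n → LoopRep Δ w₀ n
post {Δ = Δ} ψ b r = record
  { height = height r
  ; map = λ x → rfun ψ (map r x)
  ; mhom = λ x y bx by a → rpres ψ (mhom r x y bx by a)
  ; mbdry = λ x bx dx → IsEquivalence.trans (≈-eq Δ) (rresp ψ (mbdry r x bx dx)) b }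

record IsGroupIso (Γ : RGraph) (v₀ : RV Γ) (Δ : RGraph) (w₀ : RV Δ) (k k' : ℕ)
                  (Φ : LoopRep Γ v₀ (suc k) → LoopRep Δ w₀ (suc k')) : Set where
  field
    well-defined : ∀ r s → Equiv Γ v₀ (raw r) (raw s) → Equiv Δ w₀ (raw (Φ r)) (raw (Φ s))
    injective    : ∀ r s → Equiv Δ w₀ (raw (Φ r)) (raw (Φ s)) → Equiv Γ v₀ (raw r) (raw s)
    surjective   : ∀ (t : LoopRep Δ w₀ (suc k')) → Σ (LoopRep Γ v₀ (suc k)) λ r → Equiv Δ w₀ (raw (Φ r)) (raw t)
    homomorphism : ∀ r s t → Equiv Γ v₀ (raw t) (mult Γ v₀ (raw r) (raw s)) →
                   Equiv Δ w₀ (raw (Φ t)) (mult Δ w₀ (raw (Φ r)) (raw (Φ s)))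

Connected : (Γ : RGraph) → RV Γ → RV Γ → Set
Connected Γ u v = Σ ℕ λ k → Σ (ℕ → RV Γ) λ w →
  _≈_ Γ (w 0) u × _≈_ Γ (w k) v × (∀ i → i < k → _≃_ Γ (w i) (w (suc i)))

record IsBij0 (Γ : RGraph) (Δ : RGraph) (w₀ : RV Δ)
              (β : RV Γ → LoopRep Δ w₀ 1) : Set where
  field
    well-defined : ∀ u v → Connected Γ u v → Equiv Δ w₀ (raw (β u)) (raw (β v))
    injective    : ∀ u v → Equiv Δ w₀ (raw (β u)) (raw (β v)) → Connected Γ u v
    surjective   : ∀ (t : LoopRep Δ w₀ 1) → Σ (RV Γ) λ u → Equiv Δ w₀ (raw (β u)) (raw t)

-- The loop graph ΩG.  A vertex is a graph map φ : I_m → G (given by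
-- its values on 0..m) with φ 0 = ∗ and φ m = ∗.

record LoopV (G : Graph) (b : V G) : Set where
  constructor loopV
  field
    len   : ℕ
    path  : ℕ → V G
    phom  : ∀ i → suc i ≤ len → EqAdj G (path i) (path (suc i))
    start : path 0 ≡ b
    end   : path len ≡ b

open LoopV public

Ω≈ : ∀ {G b} → LoopV G b → LoopV G b → Set
Ω≈ φ ψ = len φ ≡ len ψ × (∀ i → i ≤ len φ → path φ i ≡ path ψ i)

Adj0 : ∀ {G b} → LoopV G b → LoopV G b → Set
Adj0 {G} φ₀ φ₁ = Σ (ℕ → ℕ → V G) λ Φ →
    (∀ y y' t t' → y ≤ len φ₁ → y' ≤ len φ₁ → t ≤ 1 → t' ≤ 1 →
       ((y ≡ y' × PAdj t t') ⊎ (PAdj y y' × t ≡ t')) → EqAdj G (Φ y t) (Φ y' t'))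
  × (∀ y → y ≤ len φ₁ → Φ y 0 ≡ path φ₀ (y ⊓ len φ₀))
  × (∀ y → y ≤ len φ₁ → Φ y 1 ≡ path φ₁ y)

Ω≃ : ∀ {G b} → LoopV G b → LoopV G b → Set
Ω≃ φ₀ φ₁ = (len φ₀ ≤ len φ₁ × Adj0 φ₀ φ₁) ⊎ (len φ₁ ≤ len φ₀ × Adj0 φ₁ φ₀)

private
  Ω≈-sym : ∀ {G b} {φ ψ : LoopV G b} → Ω≈ φ ψ → Ω≈ ψ φ
  Ω≈-sym {φ = φ} {ψ} (e , p) = sym e , λ i q → sym (p i (subst (i ≤_) (sym e) q))

  Ω≈-trans : ∀ {G b} {φ ψ χ : LoopV G b} → Ω≈ φ ψ → Ω≈ ψ χ → Ω≈ φ χ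
  Ω≈-trans (e , p) (e' , p') = trans e e' , λ i q → trans (p i q) (p' i (subst (i ≤_) e q))

Ω : (G : Graph) → V G → RGraph
Ω G b = record
  { RV = LoopV G b
  ; _≈_ = Ω≈
  ; ≈-eq = record { refl = refl , (λ i q → refl)
                   ; sym = λ {φ} {ψ} → Ω≈-sym {G} {b} {φ} {ψ}
                   ; trans = λ {φ} {ψ} {χ} → Ω≈-trans {G} {b} {φ} {ψ} {χ} }
  ; _≃_ = Ω≃ }

Ωbase : (G : Graph) (b : V G) → LoopV G b
Ωbase G b = loopV 0 (λ _ → b) (λ i ()) refl refl

Ωmap-v : ∀ {G bG H bH} → BasedHom G bG H bH → LoopV G bG → LoopV H bH
Ωmap-v ψ φ = loopV (len φ) (λ i → fun (hom ψ) (path φ i))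
  (λ i q → GHom-eqadj (hom ψ) (phom φ i q))
  (trans (cong (fun (hom ψ)) (start φ)) (based ψ))
  (trans (cong (fun (hom ψ)) (end φ)) (based ψ))

private
  Ωmap-adj0 : ∀ {G bG H bH} (ψ : BasedHom G bG H bH) {φ₀ φ₁ : LoopV G bG} →
              Adj0 φ₀ φ₁ → Adj0 (Ωmap-v ψ φ₀) (Ωmap-v ψ φ₁)
  Ωmap-adj0 ψ (Φ , h , e0 , e1) =
    (λ y t → fun (hom ψ) (Φ y t)) ,
    (λ y y' t t' a b c d q → GHom-eqadj (hom ψ) (h y y' t t' a b c d q)) ,
    (λ y q → cong (fun (hom ψ)) (e0 y q)) ,
    (λ y q → cong (fun (hom ψ)) (e1 y q))

  Ωmap-pres : ∀ {G bG H bH} (ψ : BasedHom G bG H bH) {φ₀ φ₁ : LoopV G bG} →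
              Ω≃ φ₀ φ₁ → Ω≃ (Ωmap-v ψ φ₀) (Ωmap-v ψ φ₁)
  Ωmap-pres ψ {φ₀} {φ₁} (inj₁ (le , a)) = inj₁ (le , Ωmap-adj0 ψ {φ₀} {φ₁} a)
  Ωmap-pres ψ {φ₀} {φ₁} (inj₂ (le , a)) = inj₂ (le , Ωmap-adj0 ψ {φ₁} {φ₀} a)

Ωmap : ∀ {G bG H bH} → BasedHom G bG H bH → RHom (Ω G bG) (Ω H bH)
Ωmap ψ = record
  { rfun = Ωmap-v ψ
  ; rresp = λ { (e , p) → e , λ i q → cong (fun (hom ψ)) (p i q) }
  ; rpres = λ {φ₀} {φ₁} → Ωmap-pres ψ {φ₀} {φ₁} }

Ωmap-based : ∀ {G bG H bH} (ψ : BasedHom G bG H bH) →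
             Ω≈ (Ωmap-v ψ (Ωbase G bG)) (Ωbase H bH)
Ωmap-based ψ = refl , λ i q → based ψ

ψ# : ∀ {G bG H bH n} → BasedHom G bG H bH → LoopRep (toR G) bG n → LoopRep (toR H) bH n
ψ# ψ = post (toRHom (hom ψ)) (based ψ)

Ωψ# : ∀ {G bG H bH n} → BasedHom G bG H bH →
      LoopRep (Ω G bG) (Ωbase G bG) n → LoopRep (Ω H bH) (Ωbase H bH) n
Ωψ# ψ = post (Ωmap ψ) (Ωmap-based ψ)

module Submission where

-- A map I^n_m → ΩG is a family of loops; reading the loop parameter as a last coordinate
-- turns it into a map I^(n+1)_N → G, for any N bounding m and all loop lengths (loops being
-- continued by their final value ∗).  Conversely, slicing a map I^(n+1)_N → G along its last
-- coordinate gives loops of length N.  Two loops are equal or adjacent in ΩG exactly when their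
-- continuations are pointwise equal or adjacent in G, so both constructions carry homotopies,
-- i.e. walks of maps, to homotopies; and slicing an uncurried family only lengthens each loop,
-- which is a single edge of ΩG.  The product concatenates along the first coordinate, untouched
-- by uncurrying; the two sides differ only in the position of the seam, which slides across the
-- constant stretch in between.  For n = 0 the same map sends a loop to a class in A_1(G), and
-- homotopies of points of ΩG are walks in ΩG.

open import Defs
open import Function using (_∘_)
open import Data.Nat using (ℕ; zero; suc; _+_; _∸_; _≤_; _<_; _≤?_; _<?_; _⊔_; _⊓_; z≤n; s≤s)
open import Data.Nat.Properties
open import Data.Fin using () renaming (zero to fzero; suc to fsuc)
open import Data.Vec using (Vec; []; _∷_; _∷ʳ_; init; last; initLast)
open import Data.Vec.Properties using (∷-injective; ∷ʳ-injective; init-∷ʳ; last-∷ʳ)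
open import Data.Vec.Relation.Unary.All as All using (all?) renaming ([] to []ᵃ; _∷_ to _∷ᵃ_)
open import Data.Vec.Relation.Unary.Any using (any?; here; there)
open import Data.Product using (Σ; _×_; _,_; proj₁; proj₂)
open import Data.Sum using (_⊎_; inj₁; inj₂)
open import Data.Bool using (if_then_else_; _∧_)
open import Data.Empty using (⊥-elim)
open import Relation.Nullary using (¬_; Dec; yes; no; does; contradiction)
open import Relation.Nullary.Decidable using (dec-true; dec-false; _⊎-dec_)
open import Relation.Binary.PropositionalEquality
open import Relation.Binary.Structures using (IsEquivalence)

PAdj-sym : ∀ {i j} → PAdj i j → PAdj j i
PAdj-sym (inj₁ e) = inj₂ e
PAdj-sym (inj₂ e) = inj₁ e

CAdj-head : ∀ {n a a′} {x : Vec ℕ n} → PAdj a a′ → CAdj (a ∷ x) (a′ ∷ x)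
CAdj-head p = fzero , refl , p

CAdj-tail : ∀ {n a} {x x′ : Vec ℕ n} → CAdj x x′ → CAdj (a ∷ x) (a ∷ x′)
CAdj-tail (j , e , p) = fsuc j , cong (_ ∷_) e , p

CAdj-[] : ¬ CAdj [] []
CAdj-[] (() , _)

CAdj-∷⁻ : ∀ {n a a′} {x x′ : Vec ℕ n} → CAdj (a ∷ x) (a′ ∷ x′) →
          (x ≡ x′ × PAdj a a′) ⊎ (a ≡ a′ × CAdj x x′)
CAdj-∷⁻ (fzero , e , p) = inj₁ (sym (proj₂ (∷-injective e)) , p)
CAdj-∷⁻ (fsuc j , e , p) = inj₂ (sym (proj₁ (∷-injective e)) , j , proj₂ (∷-injective e) , p)

CAdj-sym : ∀ {n} {x y : Vec ℕ n} → CAdj x y → CAdj y x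
CAdj-sym {x = _ ∷ _} {_ ∷ _} c with CAdj-∷⁻ c
... | inj₁ (refl , p) = CAdj-head (PAdj-sym p)
... | inj₂ (refl , c′) = CAdj-tail (CAdj-sym c′)

CAdj-∷ʳ-last : ∀ {n} (x : Vec ℕ n) {y y′} → PAdj y y′ → CAdj (x ∷ʳ y) (x ∷ʳ y′)
CAdj-∷ʳ-last [] p = CAdj-head p
CAdj-∷ʳ-last (_ ∷ x) p = CAdj-tail (CAdj-∷ʳ-last x p)

CAdj-∷ʳ-init : ∀ {n} {x x′ : Vec ℕ n} y → CAdj x x′ → CAdj (x ∷ʳ y) (x′ ∷ʳ y)
CAdj-∷ʳ-init {x = _ ∷ _} {_ ∷ _} y c with CAdj-∷⁻ c
... | inj₁ (refl , p) = CAdj-head p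
... | inj₂ (refl , c′) = CAdj-tail (CAdj-∷ʳ-init y c′)

CAdj-∷ʳ⁻ : ∀ {n} {x x′ : Vec ℕ n} {y y′} → CAdj (x ∷ʳ y) (x′ ∷ʳ y′) →
           (x ≡ x′ × PAdj y y′) ⊎ (CAdj x x′ × y ≡ y′)
CAdj-∷ʳ⁻ {x = []} {[]} c with CAdj-∷⁻ c
... | inj₁ (_ , p) = inj₁ (refl , p)
... | inj₂ (_ , c′) = ⊥-elim (CAdj-[] c′)
CAdj-∷ʳ⁻ {x = _ ∷ x} {_ ∷ x′} c with CAdj-∷⁻ c
... | inj₁ (e , p) with ∷ʳ-injective x x′ e
...   | refl , refl = inj₂ (CAdj-head p , refl)
CAdj-∷ʳ⁻ {x = _ ∷ x} {_ ∷ x′} c | inj₂ (refl , c′) with CAdj-∷ʳ⁻ c′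
...   | inj₁ (refl , p) = inj₁ (refl , p)
...   | inj₂ (c′′ , e) = inj₂ (CAdj-tail c′′ , e)

box? : ∀ {n} N (x : Vec ℕ n) → Dec (Box N x)
box? N = all? (_≤? N)

bdry? : ∀ {n} N (x : Vec ℕ n) → Dec (Bdry N x)
bdry? N = any? (λ c → (c ≟ 0) ⊎-dec (c ≟ N))

Box-mono : ∀ {n m N} {x : Vec ℕ n} → m ≤ N → Box m x → Box N x
Box-mono m≤N = All.map (λ c≤m → ≤-trans c≤m m≤N)

Box-∷ʳ⁺ : ∀ {n N} {x : Vec ℕ n} {y} → Box N x → y ≤ N → Box N (x ∷ʳ y)
Box-∷ʳ⁺ []ᵃ y≤N = y≤N ∷ᵃ []ᵃ
Box-∷ʳ⁺ (c≤N ∷ᵃ bx) y≤N = c≤N ∷ᵃ Box-∷ʳ⁺ bx y≤N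

Box-∷ʳ⁻ : ∀ {n N} (x : Vec ℕ n) {y} → Box N (x ∷ʳ y) → Box N x × y ≤ N
Box-∷ʳ⁻ [] (y≤N ∷ᵃ []ᵃ) = []ᵃ , y≤N
Box-∷ʳ⁻ (_ ∷ x) (c≤N ∷ᵃ bx) = c≤N ∷ᵃ proj₁ (Box-∷ʳ⁻ x bx) , proj₂ (Box-∷ʳ⁻ x bx)

Bdry-∷ʳ-init : ∀ {n N} {x : Vec ℕ n} {y} → Bdry N x → Bdry N (x ∷ʳ y)
Bdry-∷ʳ-init (here p) = here p
Bdry-∷ʳ-init (there d) = there (Bdry-∷ʳ-init d)

Bdry-∷ʳ-last : ∀ {n N} (x : Vec ℕ n) {y} → y ≡ 0 ⊎ y ≡ N → Bdry N (x ∷ʳ y)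
Bdry-∷ʳ-last [] p = here p
Bdry-∷ʳ-last (_ ∷ x) p = there (Bdry-∷ʳ-last x p)

Bdry-∷ʳ⁻ : ∀ {n N} (x : Vec ℕ n) {y} → Bdry N (x ∷ʳ y) → Bdry N x ⊎ (y ≡ 0 ⊎ y ≡ N)
Bdry-∷ʳ⁻ [] (here p) = inj₂ p
Bdry-∷ʳ⁻ (_ ∷ x) (here p) = inj₁ (here p)
Bdry-∷ʳ⁻ (_ ∷ x) (there d) with Bdry-∷ʳ⁻ x d
... | inj₁ d′ = inj₁ (there d′)
... | inj₂ p = inj₂ p

Bdry-shrink : ∀ {n m N} {x : Vec ℕ n} → m ≤ N → Box m x → Bdry N x → Bdry m x
Bdry-shrink _ _ (here (inj₁ c≡0)) = here (inj₁ c≡0)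
Bdry-shrink m≤N (c≤m ∷ᵃ _) (here (inj₂ refl)) = here (inj₂ (≤-antisym c≤m m≤N))
Bdry-shrink m≤N (_ ∷ᵃ bx) (there d) = there (Bdry-shrink m≤N bx d)

Bdry-exit : ∀ {n m} {x y : Vec ℕ n} → Box m x → ¬ Box m y → CAdj x y → Bdry m x
Bdry-exit {x = a ∷ x} {_ ∷ y} (a≤m ∷ᵃ bx) ∉y c with CAdj-∷⁻ c
... | inj₁ (refl , inj₁ refl) = here (inj₂ (≤-antisym a≤m (≤-pred (≰⇒> (λ 1+a≤m → ∉y (1+a≤m ∷ᵃ bx))))))
... | inj₁ (refl , inj₂ refl) = ⊥-elim (∉y (≤-trans (n≤1+n _) a≤m ∷ᵃ bx))
... | inj₂ (refl , c′) = there (Bdry-exit bx (λ by → ∉y (a≤m ∷ᵃ by)) c′)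

rangeMax : ℕ → (ℕ → ℕ) → ℕ
rangeMax zero g = g 0
rangeMax (suc N) g = rangeMax N g ⊔ g (suc N)

rangeMax-≤ : ∀ N g {c} → c ≤ N → g c ≤ rangeMax N g
rangeMax-≤ zero g z≤n = ≤-refl
rangeMax-≤ (suc N) g c≤ with m≤n⇒m<n∨m≡n c≤
... | inj₁ (s≤s c≤N) = ≤-trans (rangeMax-≤ N g c≤N) (m≤m⊔n _ _)
... | inj₂ refl = m≤n⊔m _ _

boxMax : ∀ n → ℕ → (Vec ℕ n → ℕ) → ℕ
boxMax zero N f = f []
boxMax (suc n) N f = rangeMax N (λ c → boxMax n N (f ∘ (c ∷_)))

boxMax-≤ : ∀ {n N} (f : Vec ℕ n → ℕ) {x} → Box N x → f x ≤ boxMax n N f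
boxMax-≤ f []ᵃ = ≤-refl
boxMax-≤ {suc n} {N} f {c ∷ _} (c≤N ∷ᵃ bx) =
  ≤-trans (boxMax-≤ (f ∘ (c ∷_)) bx) (rangeMax-≤ N (λ c → boxMax n N (f ∘ (c ∷_))) c≤N)

glue : ∀ {A : Set} {k} → ℕ → (Vec ℕ (suc k) → A) → (Vec ℕ (suc k) → A) → Vec ℕ (suc k) → A
glue D F F′ (c ∷ w) with c ≤? D
... | yes _ = F (c ∷ w)
... | no _ = F′ ((c ∸ D) ∷ w)

module _ {A : Set} {k : ℕ} (D : ℕ) {F F′ : Vec ℕ (suc k) → A} {c : ℕ} {w : Vec ℕ k} where

  glue-≤ : c ≤ D → glue D F F′ (c ∷ w) ≡ F (c ∷ w)
  glue-≤ c≤D with c ≤? D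
  ... | yes _ = refl
  ... | no c≰D = contradiction c≤D c≰D

  glue-≰ : ¬ c ≤ D → glue D F F′ (c ∷ w) ≡ F′ ((c ∸ D) ∷ w)
  glue-≰ c≰D with c ≤? D
  ... | yes c≤D = contradiction c≤D c≰D
  ... | no _ = refl

glue-cong : ∀ {A : Set} {k} D {F F′ H H′ : Vec ℕ (suc k) → A} →
            (∀ z → F z ≡ H z) → (∀ z → F′ z ≡ H′ z) → ∀ z → glue D F F′ z ≡ glue D H H′ z
glue-cong D eq eq′ (c ∷ w) with c ≤? D
... | yes _ = eq _
... | no _ = eq′ _

module _ {A P : Set} (p? : Dec P) (x y : A) where

  if-yes : P → (if does p? then x else y) ≡ x
  if-yes p = cong (λ d → if d then x else y) (dec-true p? p)

  if-no : ¬ P → (if does p? then x else y) ≡ y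
  if-no ¬p = cong (λ d → if d then x else y) (dec-false p? ¬p)

  if-∧-yes : ∀ {Q : Set} (q? : Dec Q) → P →
             (if does p? ∧ does q? then x else y) ≡ (if does q? then x else y)
  if-∧-yes q? p = cong (λ d → if d ∧ does q? then x else y) (dec-true p? p)

  if-∧-no : ∀ {Q : Set} (q? : Dec Q) → ¬ P → (if does p? ∧ does q? then x else y) ≡ y
  if-∧-no q? ¬p = cong (λ d → if d ∧ does q? then x else y) (dec-false p? ¬p)

module Extension (Γ : RGraph) (v₀ : RV Γ) where

  ext-inside : ∀ {n m} (f : Vec ℕ n → RV Γ) {x} → Box m x → ext Γ v₀ m f x ≡ f x
  ext-inside {m = m} f {x} = if-yes (box? m x) (f x) v₀

  ext-outside : ∀ {n m} (f : Vec ℕ n → RV Γ) {x} → ¬ Box m x → ext Γ v₀ m f x ≡ v₀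
  ext-outside {m = m} f {x} = if-no (box? m x) (f x) v₀

  module _ {k : ℕ} (m m′ : ℕ) (f g : Vec ℕ (suc k) → RV Γ) where
    private
      M : ℕ
      M = m ⊔ m′
      F G h : Vec ℕ (suc k) → RV Γ
      F = ext Γ v₀ m f
      G = ext Γ v₀ m′ g
      h = proj₂ (mult Γ v₀ (m , f) (m′ , g))

      F-off : ∀ {c xs} → ¬ Box M xs → F (c ∷ xs) ≡ v₀
      F-off ∉xs = ext-outside f λ { (_ ∷ᵃ bxs) → ∉xs (Box-mono (m≤m⊔n m m′) bxs) }

      G-off : ∀ {c xs} → ¬ Box M xs → G (c ∷ xs) ≡ v₀
      G-off ∉xs = ext-outside g λ { (_ ∷ᵃ bxs) → ∉xs (Box-mono (m≤n⊔m m m′) bxs) }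

      mult≡glue′ : ∀ c xs → Dec (c ≤ M) → Dec (Box M xs) → h (c ∷ xs) ≡ glue M F G (c ∷ xs)
      mult≡glue′ c xs (yes c≤M) (yes bxs) =
        trans (if-yes (box? M (c ∷ xs)) _ _ (c≤M ∷ᵃ bxs)) (sym (glue-≤ M c≤M))
      mult≡glue′ c xs (yes c≤M) (no ∉xs) = begin
        h (c ∷ xs)            ≡⟨ if-no (box? M (c ∷ xs)) (F (c ∷ xs)) rest (λ { (_ ∷ᵃ bxs) → ∉xs bxs }) ⟩
        rest                  ≡⟨ if-∧-no (M <? c) G₂ v₀ (box? M xs) (≤⇒≯ c≤M) ⟩
        v₀                    ≡⟨ F-off ∉xs ⟨
        F (c ∷ xs)            ≡⟨ glue-≤ M c≤M ⟨
        glue M F G (c ∷ xs)   ∎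
        where
        open ≡-Reasoning
        G₂ rest : RV Γ
        G₂ = G ((c ∸ M) ∷ xs)
        rest = if does (M <? c) ∧ does (box? M xs) then G₂ else v₀
      mult≡glue′ c xs (no c≰M) bxs? = begin
        h (c ∷ xs)            ≡⟨ if-no (box? M (c ∷ xs)) (F (c ∷ xs)) rest (λ { (c≤M ∷ᵃ _) → c≰M c≤M }) ⟩
        rest                  ≡⟨ if-∧-yes (M <? c) G₂ v₀ (box? M xs) (≰⇒> c≰M) ⟩
        _                     ≡⟨ G-branch bxs? ⟩
        G ((c ∸ M) ∷ xs)      ≡⟨ glue-≰ M c≰M ⟨
        glue M F G (c ∷ xs)   ∎
        where
        open ≡-Reasoning
        G₂ rest : RV Γ
        G₂ = G ((c ∸ M) ∷ xs)
        rest = if does (M <? c) ∧ does (box? M xs) then G₂ else v₀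
        G-branch : Dec (Box M xs) → (if does (box? M xs) then G₂ else v₀) ≡ G₂
        G-branch (yes bxs) = if-yes (box? M xs) G₂ v₀ bxs
        G-branch (no ∉xs) = trans (if-no (box? M xs) G₂ v₀ ∉xs) (sym (G-off ∉xs))

      mult≡glue : ∀ z → h z ≡ glue M F G z
      mult≡glue (c ∷ xs) = mult≡glue′ c xs (c ≤? M) (box? M xs)

    ext-mult≡glue : ∀ z → ext Γ v₀ (M + M) h z ≡ glue M F G z
    ext-mult≡glue z with box? (M + M) z
    ext-mult≡glue z | yes _ = mult≡glue z
    ext-mult≡glue (c ∷ xs) | no ∉z with c ≤? M
    ... | yes c≤M = sym (ext-outside f (∉z ∘ Box-mono (≤-trans (m≤m⊔n m m′) (m≤m+n M M))))
    ... | no c≰M = sym (ext-outside g λ { (c∸M≤m′ ∷ᵃ bxs) →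
            ∉z (≤-trans (m≤n+m∸n c M) (+-monoʳ-≤ M (≤-trans c∸M≤m′ (m≤n⊔m m m′)))
                ∷ᵃ Box-mono (≤-trans (m≤n⊔m m m′) (m≤m+n M M)) bxs) })

module BoxMaps (Γ : RGraph) (v₀ : RV Γ)
  (≃-refl : ∀ a → _≃_ Γ a a)
  (≃-sym : ∀ {a a′} → _≃_ Γ a a′ → _≃_ Γ a′ a)
  (≃-resp : ∀ {a a′ c c′} → _≈_ Γ a a′ → _≈_ Γ c c′ → _≃_ Γ a c → _≃_ Γ a′ c′) where

  open Extension Γ v₀ public
  open IsEquivalence (≈-eq Γ) public
    using () renaming (refl to ≈-refl; sym to ≈-sym; trans to ≈-trans; reflexive to ≈-reflexive)

  infix 4 _≈Γ_ _≃Γ_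
  _≈Γ_ _≃Γ_ : RV Γ → RV Γ → Set
  _≈Γ_ = _≈_ Γ
  _≃Γ_ = _≃_ Γ

  ≈v₀⇒≃ : ∀ {a c} → a ≈Γ v₀ → c ≈Γ v₀ → a ≃Γ c
  ≈v₀⇒≃ a≈v₀ c≈v₀ = ≃-resp (≈-sym a≈v₀) (≈-sym c≈v₀) (≃-refl v₀)

  -- Maps are taken on all of ℕⁿ, constant v₀ off I^n_N, so that the height N can be raised freely.
  record BoxMap {n} (N : ℕ) (f : Vec ℕ n → RV Γ) : Set where
    field
      adj      : ∀ x y → CAdj x y → f x ≃Γ f y
      boundary : ∀ x → Box N x → Bdry N x → f x ≈Γ v₀
      outside  : ∀ x → ¬ Box N x → f x ≈Γ v₀

  open BoxMap public

  toLoopRep : ∀ {n N} {f : Vec ℕ n → RV Γ} → BoxMap N f → LoopRep Γ v₀ n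
  toLoopRep {N = N} {f} F = record
    { height = N ; map = f ; mhom = λ x y _ _ → adj F x y ; mbdry = boundary F }

  ext-boxMap : ∀ {n m} {f : Vec ℕ n → RV Γ} →
    (∀ x y → Box m x → Box m y → CAdj x y → f x ≃Γ f y) →
    (∀ x → Box m x → Bdry m x → f x ≈Γ v₀) → BoxMap m (ext Γ v₀ m f)
  ext-boxMap {m = m} {f} hom bd = record
    { adj = adj′
    ; boundary = λ x bx dx → ≈-trans (≈-reflexive (ext-inside f bx)) (bd x bx dx)
    ; outside = λ x ∉x → ≈-reflexive (ext-outside f ∉x) }
    where
    adj′ : ∀ x y → CAdj x y → ext Γ v₀ m f x ≃Γ ext Γ v₀ m f y
    adj′ x y c with box? m x | box? m y
    ... | yes bx | yes by = hom x y bx by c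
    ... | yes bx | no ∉y = ≈v₀⇒≃ (bd x bx (Bdry-exit bx ∉y c)) ≈-refl
    ... | no ∉x | yes by = ≈v₀⇒≃ ≈-refl (bd y by (Bdry-exit by ∉x (CAdj-sym c)))
    ... | no _ | no _ = ≃-refl v₀

  extRep : ∀ {n} → LoopRep Γ v₀ n → Vec ℕ n → RV Γ
  extRep r = ext Γ v₀ (height r) (map r)

  extRep-boxMap : ∀ {n} (r : LoopRep Γ v₀ n) → BoxMap (height r) (extRep r)
  extRep-boxMap r = ext-boxMap (mhom r) (mbdry r)

  boxMap-mono : ∀ {n m N} {f : Vec ℕ n → RV Γ} → m ≤ N → BoxMap m f → BoxMap N f
  boxMap-mono {m = m} {N} {f} m≤N F = record
    { adj = adj F
    ; boundary = boundary′
    ; outside = λ x ∉x → outside F x (∉x ∘ Box-mono m≤N) }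
    where
    boundary′ : ∀ x → Box N x → Bdry N x → f x ≈Γ v₀
    boundary′ x bx dx with box? m x
    ... | yes bx′ = boundary F x bx′ (Bdry-shrink m≤N bx′ dx)
    ... | no ∉x = outside F x ∉x

  boxMap-resp : ∀ {n N} {f g : Vec ℕ n → RV Γ} → (∀ x → f x ≈Γ g x) → BoxMap N f → BoxMap N g
  boxMap-resp f≈g F = record
    { adj = λ x y c → ≃-resp (f≈g x) (f≈g y) (adj F x y c)
    ; boundary = λ x bx dx → ≈-trans (≈-sym (f≈g x)) (boundary F x bx dx)
    ; outside = λ x ∉x → ≈-trans (≈-sym (f≈g x)) (outside F x ∉x) }

  boxMap-ext : ∀ {n N} {f : Vec ℕ n → RV Γ} → BoxMap N f → ∀ x → ext Γ v₀ N f x ≈Γ f x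
  boxMap-ext {N = N} {f} F x with box? N x
  ... | yes _ = ≈-refl
  ... | no ∉x = ≈-sym (outside F x ∉x)

  boxMap-beyond : ∀ {k N} {f : Vec ℕ (suc k) → RV Γ} → BoxMap N f → ∀ {c} w → N ≤ c → f (c ∷ w) ≈Γ v₀
  boxMap-beyond {N = N} F {c} w N≤c with box? N (c ∷ w)
  ... | yes bz@(c≤N ∷ᵃ _) = boundary F _ bz (here (inj₂ (≤-antisym c≤N N≤c)))
  ... | no ∉z = outside F _ ∉z

  boxMap-at-0 : ∀ {k N} {f : Vec ℕ (suc k) → RV Γ} → BoxMap N f → ∀ w → f (0 ∷ w) ≈Γ v₀
  boxMap-at-0 {N = N} F w with box? N (0 ∷ w)
  ... | yes bz = boundary F _ bz (here (inj₁ refl))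
  ... | no ∉z = outside F _ ∉z

  -- Homotopies rel ∂I^n_N in inductive form (see walk⇒homotopic and homotopic⇒walk).
  data BoxWalk {n} (N : ℕ) : (f g : Vec ℕ n → RV Γ) → Set where
    stay : ∀ {f g} → BoxMap N f → (∀ x → f x ≈Γ g x) → BoxWalk N f g
    move : ∀ {f g h} → BoxMap N f → (∀ x → f x ≃Γ g x) → BoxWalk N g h → BoxWalk N f h

  module _ {n N : ℕ} where

    walk-start : ∀ {f g : Vec ℕ n → RV Γ} → BoxWalk N f g → BoxMap N f
    walk-start (stay F _) = F
    walk-start (move F _ _) = F

    walk-respˡ : ∀ {f f′ g : Vec ℕ n → RV Γ} → (∀ x → f′ x ≈Γ f x) → BoxWalk N f g → BoxWalk N f′ g
    walk-respˡ e (stay F f≈g) = stay (boxMap-resp (≈-sym ∘ e) F) (λ x → ≈-trans (e x) (f≈g x))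
    walk-respˡ e (move F f≃g w) =
      move (boxMap-resp (≈-sym ∘ e) F) (λ x → ≃-resp (≈-sym (e x)) ≈-refl (f≃g x)) w

    walk-respʳ : ∀ {f g g′ : Vec ℕ n → RV Γ} → BoxWalk N f g → (∀ x → g x ≈Γ g′ x) → BoxWalk N f g′
    walk-respʳ (stay F f≈g) e = stay F (λ x → ≈-trans (f≈g x) (e x))
    walk-respʳ (move F f≃g w) e = move F f≃g (walk-respʳ w e)

    walk-trans : ∀ {f g h : Vec ℕ n → RV Γ} → BoxWalk N f g → BoxWalk N g h → BoxWalk N f h
    walk-trans (stay _ f≈g) w′ = walk-respˡ f≈g w′
    walk-trans (move F f≃g w) w′ = move F f≃g (walk-trans w w′)

    walk-sym : ∀ {f g : Vec ℕ n → RV Γ} → BoxWalk N f g → BoxWalk N g f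
    walk-sym (stay F f≈g) = stay (boxMap-resp f≈g F) (≈-sym ∘ f≈g)
    walk-sym (move F f≃g w) =
      walk-trans (walk-sym w) (move (walk-start w) (≃-sym ∘ f≃g) (stay F (λ _ → ≈-refl)))

    walk-mono : ∀ {N′} {f g : Vec ℕ n → RV Γ} → N ≤ N′ → BoxWalk N f g → BoxWalk N′ f g
    walk-mono N≤N′ (stay F f≈g) = stay (boxMap-mono N≤N′ F) f≈g
    walk-mono N≤N′ (move F f≃g w) = move (boxMap-mono N≤N′ F) f≃g (walk-mono N≤N′ w)

    private
      steps : ∀ {f g : Vec ℕ n → RV Γ} → BoxWalk N f g → ℕ
      steps (stay _ _) = 0
      steps (move _ _ w) = suc (steps w)

      stage : ∀ {f g : Vec ℕ n → RV Γ} → BoxWalk N f g → ℕ → Vec ℕ n → RV Γ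
      stage (stay {f} _ _) _ = f
      stage (move {f} _ _ _) zero = f
      stage (move _ _ w) (suc t) = stage w t

      stage-boxMap : ∀ {f g : Vec ℕ n → RV Γ} (w : BoxWalk N f g) t → BoxMap N (stage w t)
      stage-boxMap (stay F _) _ = F
      stage-boxMap (move F _ _) zero = F
      stage-boxMap (move _ _ w) (suc t) = stage-boxMap w t

      stage-step : ∀ {f g : Vec ℕ n → RV Γ} (w : BoxWalk N f g) t x → stage w t x ≃Γ stage w (suc t) x
      stage-step (stay _ _) _ x = ≃-refl _
      stage-step (move _ f≃g (stay _ _)) zero x = f≃g x
      stage-step (move _ f≃g (move _ _ _)) zero x = f≃g x
      stage-step (move _ _ w) (suc t) x = stage-step w t x

      stage-start : ∀ {f g : Vec ℕ n → RV Γ} (w : BoxWalk N f g) x → stage w 0 x ≈Γ f x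
      stage-start (stay _ _) x = ≈-refl
      stage-start (move _ _ _) x = ≈-refl

      stage-end : ∀ {f g : Vec ℕ n → RV Γ} (w : BoxWalk N f g) x → stage w (steps w) x ≈Γ g x
      stage-end (stay _ f≈g) x = f≈g x
      stage-end (move _ _ w) x = stage-end w x

    walk⇒homotopic : ∀ {f g : Vec ℕ n → RV Γ} → BoxWalk N f g → Homotopic Γ v₀ N f g
    walk⇒homotopic w =
      steps w , (λ x t → stage w t x) , adj′ , (λ x _ → stage-start w x) , (λ x _ → stage-end w x) ,
      (λ x t bx dx _ → boundary (stage-boxMap w t) x bx dx)
      where
      adj′ : ∀ x y t s → Box N x → Box N y → t ≤ steps w → s ≤ steps w →
             (CAdj x y × t ≡ s) ⊎ (x ≡ y × PAdj t s) → stage w t x ≃Γ stage w s y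
      adj′ x y t _ _ _ _ _ (inj₁ (c , refl)) = adj (stage-boxMap w t) x y c
      adj′ x _ t _ _ _ _ _ (inj₂ (refl , inj₁ refl)) = stage-step w t x
      adj′ x _ _ s _ _ _ _ (inj₂ (refl , inj₂ refl)) = ≃-sym (stage-step w s x)

    homotopic⇒walk : ∀ {f g : Vec ℕ n → RV Γ} →
      (∀ x → ¬ Box N x → f x ≈Γ v₀) → (∀ x → ¬ Box N x → g x ≈Γ v₀) →
      Homotopic Γ v₀ N f g → BoxWalk N f g
    homotopic⇒walk {f} {g} f-off g-off (l , H , hadj , h₀ , hₗ , hbd) =
      walk-respʳ (walk-respˡ (agree f-off h₀) (walkTo l ≤-refl)) (≈-sym ∘ agree g-off hₗ)
      where
      K : ℕ → Vec ℕ n → RV Γ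
      K t = ext Γ v₀ N (λ x → H x t)

      K-boxMap : ∀ t → t ≤ l → BoxMap N (K t)
      K-boxMap t t≤l = ext-boxMap (λ x y bx by c → hadj x y t t bx by t≤l t≤l (inj₁ (c , refl)))
                                  (λ x bx dx → hbd x t bx dx t≤l)

      K-step : ∀ t → t < l → ∀ x → K t x ≃Γ K (suc t) x
      K-step t t<l x with box? N x
      ... | yes bx = hadj x x t (suc t) bx bx (<⇒≤ t<l) t<l (inj₂ (refl , inj₁ refl))
      ... | no _ = ≃-refl v₀

      walkTo : ∀ t → t ≤ l → BoxWalk N (K 0) (K t)
      walkTo zero _ = stay (K-boxMap 0 z≤n) (λ _ → ≈-refl)
      walkTo (suc t) t<l = walk-trans (walkTo t (<⇒≤ t<l))
        (move (K-boxMap t (<⇒≤ t<l)) (K-step t t<l) (stay (K-boxMap (suc t) t<l) (λ _ → ≈-refl)))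

      agree : ∀ {t} {h : Vec ℕ n → RV Γ} → (∀ x → ¬ Box N x → h x ≈Γ v₀) →
              (∀ x → Box N x → H x t ≈Γ h x) → ∀ x → h x ≈Γ K t x
      agree h-off H≈h x with box? N x
      ... | yes bx = ≈-sym (H≈h x bx)
      ... | no ∉x = h-off x ∉x

  Equiv⇒walk : ∀ {n m m′} {f g : Vec ℕ n → RV Γ} → Equiv Γ v₀ (m , f) (m′ , g) →
               Σ ℕ λ N → m ≤ N × m′ ≤ N × BoxWalk N (ext Γ v₀ m f) (ext Γ v₀ m′ g)
  Equiv⇒walk {f = f} {g} (N , m≤N , m′≤N , H) =
    N , m≤N , m′≤N , homotopic⇒walk (λ x ∉x → ≈-reflexive (ext-outside f (∉x ∘ Box-mono m≤N)))
                                    (λ x ∉x → ≈-reflexive (ext-outside g (∉x ∘ Box-mono m′≤N))) H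

  walk⇒Equiv : ∀ {n m m′ N} {f g : Vec ℕ n → RV Γ} →
               BoxWalk N (ext Γ v₀ m f) (ext Γ v₀ m′ g) → Equiv Γ v₀ (m , f) (m′ , g)
  walk⇒Equiv {m = m} {m′} {N} w =
    N ⊔ (m ⊔ m′) , ≤-trans (m≤m⊔n m m′) (m≤n⊔m N _) , ≤-trans (m≤n⊔m m m′) (m≤n⊔m N _) ,
    walk⇒homotopic (walk-mono (m≤m⊔n N _) w)

  Equiv⇒boxWalk : ∀ {n m m′} {f g : Vec ℕ n → RV Γ} → BoxMap m f → BoxMap m′ g →
                  Equiv Γ v₀ (m , f) (m′ , g) → Σ ℕ λ N → m ≤ N × m′ ≤ N × BoxWalk N f g
  Equiv⇒boxWalk F G f~g with Equiv⇒walk f~g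
  ... | N , m≤N , m′≤N , w =
    N , m≤N , m′≤N , walk-respʳ (walk-respˡ (≈-sym ∘ boxMap-ext F) w) (boxMap-ext G)

  boxWalk⇒Equiv : ∀ {n m m′ N} {f g : Vec ℕ n → RV Γ} → BoxMap m f → BoxMap m′ g →
                  BoxWalk N f g → Equiv Γ v₀ (m , f) (m′ , g)
  boxWalk⇒Equiv F G w = walk⇒Equiv (walk-respʳ (walk-respˡ (boxMap-ext F) w) (≈-sym ∘ boxMap-ext G))

  extRep≈⇒Equiv : ∀ {n} (r s : LoopRep Γ v₀ n) → (∀ x → extRep r x ≈Γ extRep s x) →
                  Equiv Γ v₀ (raw r) (raw s)
  extRep≈⇒Equiv r s r≈s = walk⇒Equiv (stay (extRep-boxMap r) r≈s)

module LoopGraph (G : Graph) (b : V G) where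

  EqAdj-sym : ∀ {u v} → EqAdj G u v → EqAdj G v u
  EqAdj-sym (inj₁ u≡v) = inj₁ (sym u≡v)
  EqAdj-sym (inj₂ a) = inj₂ (E-sym G a)

  EqAdj-resp : ∀ {u u′ v v′} → u ≡ u′ → v ≡ v′ → EqAdj G u v → EqAdj G u′ v′
  EqAdj-resp refl refl a = a

  ∗ : LoopV G b
  ∗ = Ωbase G b

  infix 4 _≈Ω_ _≃Ω_
  _≈Ω_ _≃Ω_ : LoopV G b → LoopV G b → Set
  _≈Ω_ = Ω≈
  _≃Ω_ = Ω≃

  loopAt : LoopV G b → ℕ → V G
  loopAt φ y = path φ (y ⊓ len φ)

  loopAt-beyond : ∀ φ {y} → len φ ≤ y → loopAt φ y ≡ b
  loopAt-beyond φ len≤y = trans (cong (path φ) (m≥n⇒m⊓n≡n len≤y)) (end φ)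

  loopAt-within : ∀ φ {y} → y ≤ len φ → loopAt φ y ≡ path φ y
  loopAt-within φ y≤len = cong (path φ) (m≤n⇒m⊓n≡m y≤len)

  loopAt-cong : ∀ {φ ψ} → φ ≈Ω ψ → ∀ y → loopAt φ y ≡ loopAt ψ y
  loopAt-cong {φ} {ψ} (len≡ , path≡) y =
    trans (path≡ (y ⊓ len φ) (m⊓n≤n y (len φ))) (cong (λ l → path ψ (y ⊓ l)) len≡)

  loopAt-∗ : ∀ {φ} → φ ≈Ω ∗ → ∀ y → loopAt φ y ≡ b
  loopAt-∗ {φ} φ≈∗ = loopAt-cong {φ} {∗} φ≈∗

  loopAt-suc : ∀ φ y → EqAdj G (loopAt φ y) (loopAt φ (suc y))
  loopAt-suc φ y with suc y ≤? len φ
  ... | yes y<len =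
    EqAdj-resp (sym (loopAt-within φ (<⇒≤ y<len))) (sym (loopAt-within φ y<len)) (phom φ y y<len)
  ... | no y≮len = inj₁ (trans (loopAt-beyond φ len≤y) (sym (loopAt-beyond φ (m≤n⇒m≤1+n len≤y))))
    where
    len≤y : len φ ≤ y
    len≤y = ≤-pred (≰⇒> y≮len)

  loopAt-adj : ∀ φ {y y′} → PAdj y y′ → EqAdj G (loopAt φ y) (loopAt φ y′)
  loopAt-adj φ (inj₁ refl) = loopAt-suc φ _
  loopAt-adj φ (inj₂ refl) = EqAdj-sym (loopAt-suc φ _)

  private
    Adj0⇒loopAt : ∀ φ ψ → len φ ≤ len ψ → Adj0 φ ψ → ∀ y → EqAdj G (loopAt φ y) (loopAt ψ y)
    Adj0⇒loopAt φ ψ φ≤ψ (Φ , Φ-hom , Φ₀ , Φ₁) y with y ≤? len ψ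
    ... | yes y≤ψ = EqAdj-resp (Φ₀ y y≤ψ) (trans (Φ₁ y y≤ψ) (sym (loopAt-within ψ y≤ψ)))
                      (Φ-hom y y 0 1 y≤ψ y≤ψ z≤n ≤-refl (inj₁ (refl , inj₁ refl)))
    ... | no y≰ψ = inj₁ (trans (loopAt-beyond φ (≤-trans φ≤ψ ψ≤y)) (sym (loopAt-beyond ψ ψ≤y)))
      where
      ψ≤y : len ψ ≤ y
      ψ≤y = <⇒≤ (≰⇒> y≰ψ)

    loopAt⇒Adj0 : ∀ φ ψ → len φ ≤ len ψ → (∀ y → y ≤ len ψ → EqAdj G (loopAt φ y) (loopAt ψ y)) →
                  Adj0 φ ψ
    loopAt⇒Adj0 φ ψ φ≤ψ φ≃ψ = Φ , Φ-hom , (λ _ _ → refl) , (λ _ y≤ψ → loopAt-within ψ y≤ψ)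
      where
      Φ : ℕ → ℕ → V G
      Φ y zero = loopAt φ y
      Φ y (suc _) = loopAt ψ y
      Φ-hom : ∀ y y′ t t′ → y ≤ len ψ → y′ ≤ len ψ → t ≤ 1 → t′ ≤ 1 →
              (y ≡ y′ × PAdj t t′) ⊎ (PAdj y y′ × t ≡ t′) → EqAdj G (Φ y t) (Φ y′ t′)
      Φ-hom y _ zero _ y≤ψ _ _ _ (inj₁ (refl , inj₁ refl)) = φ≃ψ y y≤ψ
      Φ-hom y _ _ zero y≤ψ _ _ _ (inj₁ (refl , inj₂ refl)) = EqAdj-sym (φ≃ψ y y≤ψ)
      Φ-hom _ _ (suc _) _ _ _ _ (s≤s ()) (inj₁ (refl , inj₁ refl))
      Φ-hom _ _ _ (suc _) _ _ (s≤s ()) _ (inj₁ (refl , inj₂ refl))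
      Φ-hom _ _ zero _ _ _ _ _ (inj₂ (y~y′ , refl)) = loopAt-adj φ y~y′
      Φ-hom _ _ (suc _) _ _ _ _ _ (inj₂ (y~y′ , refl)) = loopAt-adj ψ y~y′

  Ω≃⇒loopAt : ∀ {φ ψ} → φ ≃Ω ψ → ∀ y → EqAdj G (loopAt φ y) (loopAt ψ y)
  Ω≃⇒loopAt {φ} {ψ} (inj₁ (φ≤ψ , a)) y = Adj0⇒loopAt φ ψ φ≤ψ a y
  Ω≃⇒loopAt {φ} {ψ} (inj₂ (ψ≤φ , a)) y = EqAdj-sym (Adj0⇒loopAt ψ φ ψ≤φ a y)

  loopAt⇒Ω≃ : ∀ {φ ψ} N → len φ ≤ N → len ψ ≤ N →
              (∀ y → y ≤ N → EqAdj G (loopAt φ y) (loopAt ψ y)) → φ ≃Ω ψ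
  loopAt⇒Ω≃ {φ} {ψ} N φ≤N ψ≤N φ≃ψ with ≤-total (len φ) (len ψ)
  ... | inj₁ φ≤ψ = inj₁ (φ≤ψ , loopAt⇒Adj0 φ ψ φ≤ψ (λ y y≤ψ → φ≃ψ y (≤-trans y≤ψ ψ≤N)))
  ... | inj₂ ψ≤φ = inj₂ (ψ≤φ , loopAt⇒Adj0 ψ φ ψ≤φ (λ y y≤φ → EqAdj-sym (φ≃ψ y (≤-trans y≤φ φ≤N))))

  Ω≃-refl : ∀ φ → φ ≃Ω φ
  Ω≃-refl φ = loopAt⇒Ω≃ {φ} {φ} (len φ) ≤-refl ≤-refl (λ _ _ → inj₁ refl)

  Ω≃-sym : ∀ {φ ψ} → φ ≃Ω ψ → ψ ≃Ω φ
  Ω≃-sym (inj₁ a) = inj₂ a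
  Ω≃-sym (inj₂ a) = inj₁ a

  Ω≃-resp : ∀ {φ φ′ ψ ψ′} → φ ≈Ω φ′ → ψ ≈Ω ψ′ → φ ≃Ω ψ → φ′ ≃Ω ψ′
  Ω≃-resp {φ} {φ′} {ψ} {ψ′} φ≈φ′ ψ≈ψ′ φ≃ψ =
    loopAt⇒Ω≃ {φ′} {ψ′} (len φ′ ⊔ len ψ′) (m≤m⊔n _ _) (m≤n⊔m _ _) (λ y _ →
      EqAdj-resp (loopAt-cong {φ} {φ′} φ≈φ′ y) (loopAt-cong {ψ} {ψ′} ψ≈ψ′ y) (Ω≃⇒loopAt {φ} {ψ} φ≃ψ y))

  module ΩM = BoxMaps (Ω G b) ∗ Ω≃-refl (λ {φ} {ψ} → Ω≃-sym {φ} {ψ})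
                      (λ {φ} {φ′} {ψ} {ψ′} → Ω≃-resp {φ} {φ′} {ψ} {ψ′})
  module GM = BoxMaps (toR G) b (λ _ → inj₁ refl) EqAdj-sym EqAdj-resp

module Currying (G : Graph) (b : V G) where
  open LoopGraph G b

  uncurryΩ : ∀ {n} → (Vec ℕ n → LoopV G b) → Vec ℕ (suc n) → V G
  uncurryΩ F z = loopAt (F (init z)) (last z)

  uncurryΩ-∷ʳ : ∀ {n} (F : Vec ℕ n → LoopV G b) x y → uncurryΩ F (x ∷ʳ y) ≡ loopAt (F x) y
  uncurryΩ-∷ʳ F x y = cong₂ (λ x′ y′ → loopAt (F x′) y′) (init-∷ʳ y x) (last-∷ʳ y x)

  module _ {n : ℕ} {F F′ : Vec ℕ n → LoopV G b} where

    uncurryΩ-cong : (∀ x → F x ≈Ω F′ x) → ∀ z → uncurryΩ F z ≡ uncurryΩ F′ z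
    uncurryΩ-cong F≈F′ z = loopAt-cong {F (init z)} {F′ (init z)} (F≈F′ (init z)) (last z)

    uncurryΩ-adj : (∀ x → F x ≃Ω F′ x) → ∀ z → EqAdj G (uncurryΩ F z) (uncurryΩ F′ z)
    uncurryΩ-adj F≃F′ z = Ω≃⇒loopAt {F (init z)} {F′ (init z)} (F≃F′ (init z)) (last z)

  uncurryΩ-boxMap : ∀ {n N} {F : Vec ℕ n → LoopV G b} → ΩM.BoxMap N F → (∀ x → len (F x) ≤ N) →
                    GM.BoxMap N (uncurryΩ F)
  uncurryΩ-boxMap {N = N} {F} Fm len≤N = record { adj = adj′ ; boundary = boundary′ ; outside = outside′ }
    where
    adj′ : ∀ z z′ → CAdj z z′ → EqAdj G (uncurryΩ F z) (uncurryΩ F z′)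
    adj′ z z′ c with initLast z | initLast z′
    ... | x , y , refl | x′ , y′ , refl = split (CAdj-∷ʳ⁻ c)
      where
      split : (x ≡ x′ × PAdj y y′) ⊎ (CAdj x x′ × y ≡ y′) → EqAdj G (loopAt (F x) y) (loopAt (F x′) y′)
      split (inj₁ (refl , y~y′)) = loopAt-adj (F x) y~y′
      split (inj₂ (x~x′ , refl)) = Ω≃⇒loopAt {F x} {F x′} (ΩM.adj Fm x x′ x~x′) y

    boundary′ : ∀ z → Box N z → Bdry N z → uncurryΩ F z ≡ b
    boundary′ z bz dz with initLast z
    ... | x , y , refl with Bdry-∷ʳ⁻ x dz
    ...   | inj₁ dx = loopAt-∗ {F x} (ΩM.boundary Fm x (proj₁ (Box-∷ʳ⁻ x bz)) dx) y
    ...   | inj₂ (inj₁ refl) = start (F x)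
    ...   | inj₂ (inj₂ refl) = loopAt-beyond (F x) (len≤N x)

    outside′ : ∀ z → ¬ Box N z → uncurryΩ F z ≡ b
    outside′ z ∉z with initLast z
    ... | x , y , refl with box? N x
    ...   | yes bx = loopAt-beyond (F x) (≤-trans (len≤N x) (<⇒≤ (≰⇒> (∉z ∘ Box-∷ʳ⁺ bx))))
    ...   | no ∉x = loopAt-∗ {F x} (ΩM.outside Fm x ∉x) y

  lengthBound : ∀ {n} → ℕ → (Vec ℕ n → LoopV G b) → ℕ
  lengthBound {n} N F = boxMax n N (len ∘ F)

  len≤lengthBound : ∀ {n N} {F : Vec ℕ n → LoopV G b} → ΩM.BoxMap N F → ∀ x → len (F x) ≤ lengthBound N F
  len≤lengthBound {N = N} {F} Fm x with box? N x
  ... | yes bx = boxMax-≤ (len ∘ F) bx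
  ... | no ∉x = ≤-trans (≤-reflexive (proj₁ (ΩM.outside Fm x ∉x))) z≤n

  walkLengthBound : ∀ {n N} {F F′ : Vec ℕ n → LoopV G b} → ΩM.BoxWalk N F F′ → ℕ
  walkLengthBound {N = N} (ΩM.stay {F} _ _) = lengthBound N F
  walkLengthBound {N = N} (ΩM.move {F} _ _ w) = lengthBound N F ⊔ walkLengthBound w

  private
    uncurryΩ-walk′ : ∀ {n N N′} {F F′ : Vec ℕ n → LoopV G b} (w : ΩM.BoxWalk N F F′) →
                     N ≤ N′ → walkLengthBound w ≤ N′ → GM.BoxWalk N′ (uncurryΩ F) (uncurryΩ F′)
    uncurryΩ-walk′ {F = F} {F′} (ΩM.stay Fm F≈F′) N≤N′ bound≤N′ =
      GM.stay (uncurryΩ-boxMap (ΩM.boxMap-mono N≤N′ Fm) (λ x → ≤-trans (len≤lengthBound Fm x) bound≤N′))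
              (uncurryΩ-cong {F = F} {F′} F≈F′)
    uncurryΩ-walk′ {F = F} (ΩM.move {g = F′} Fm F≃F′ w) N≤N′ bound≤N′ =
      GM.move (uncurryΩ-boxMap (ΩM.boxMap-mono N≤N′ Fm)
                               (λ x → ≤-trans (len≤lengthBound Fm x) (≤-trans (m≤m⊔n _ _) bound≤N′)))
              (uncurryΩ-adj {F = F} {F′} F≃F′)
              (uncurryΩ-walk′ w N≤N′ (≤-trans (m≤n⊔m _ _) bound≤N′))

  uncurryΩ-walk : ∀ {n N} {F F′ : Vec ℕ n → LoopV G b} (w : ΩM.BoxWalk N F F′) →
                  GM.BoxWalk (N ⊔ walkLengthBound w) (uncurryΩ F) (uncurryΩ F′)
  uncurryΩ-walk w = uncurryΩ-walk′ w (m≤m⊔n _ _) (m≤n⊔m _ _)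

  module _ {n N : ℕ} (g : Vec ℕ (suc n) → V G) (gm : GM.BoxMap N g) where

    private
      g-off : ∀ {z} → ¬ Box N z → g z ≡ b
      g-off = GM.outside gm _

      slice : ∀ {x} → Box N x → LoopV G b
      slice {x} bx = loopV N (λ y → g (x ∷ʳ y))
        (λ _ _ → GM.adj gm _ _ (CAdj-∷ʳ-last x (inj₁ refl)))
        (GM.boundary gm _ (Box-∷ʳ⁺ bx z≤n) (Bdry-∷ʳ-last x (inj₁ refl)))
        (GM.boundary gm _ (Box-∷ʳ⁺ bx ≤-refl) (Bdry-∷ʳ-last x (inj₂ refl)))

    -- Off the interior the slice must be ∗ itself: a constant loop of positive length is not ≈ ∗.
    curryΩ : Vec ℕ n → LoopV G b
    curryΩ x with box? N x | bdry? N x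
    ... | yes bx | no _ = slice bx
    ... | _ | _ = ∗

    len-curryΩ : ∀ x → len (curryΩ x) ≤ N
    len-curryΩ x with box? N x | bdry? N x
    ... | yes _ | no _ = ≤-refl
    ... | yes _ | yes _ = z≤n
    ... | no _ | _ = z≤n

    loopAt-curryΩ : ∀ x y → loopAt (curryΩ x) y ≡ g (x ∷ʳ y)
    loopAt-curryΩ x y with box? N x | bdry? N x | y ≤? N
    ... | yes bx | no _ | yes y≤N = cong (λ k → g (x ∷ʳ k)) (m≤n⇒m⊓n≡m y≤N)
    ... | yes bx | no _ | no y≰N =
      trans (loopAt-beyond (slice bx) (<⇒≤ (≰⇒> y≰N))) (sym (g-off (y≰N ∘ proj₂ ∘ Box-∷ʳ⁻ x)))
    ... | yes bx | yes dx | yes y≤N = sym (GM.boundary gm _ (Box-∷ʳ⁺ bx y≤N) (Bdry-∷ʳ-init dx))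
    ... | yes bx | yes dx | no y≰N = sym (g-off (y≰N ∘ proj₂ ∘ Box-∷ʳ⁻ x))
    ... | no ∉x | _ | _ = sym (g-off (∉x ∘ proj₁ ∘ Box-∷ʳ⁻ x))

    uncurryΩ-curryΩ : ∀ z → uncurryΩ curryΩ z ≡ g z
    uncurryΩ-curryΩ z with initLast z
    ... | x , y , refl = loopAt-curryΩ x y

    curryΩ-boxMap : ΩM.BoxMap N curryΩ
    curryΩ-boxMap = record { adj = adj′ ; boundary = boundary′ ; outside = outside′ }
      where
      adj′ : ∀ x x′ → CAdj x x′ → curryΩ x ≃Ω curryΩ x′
      adj′ x x′ c = loopAt⇒Ω≃ {curryΩ x} {curryΩ x′} N (len-curryΩ x) (len-curryΩ x′) λ y _ →
        EqAdj-resp (sym (loopAt-curryΩ x y)) (sym (loopAt-curryΩ x′ y)) (GM.adj gm _ _ (CAdj-∷ʳ-init y c))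

      boundary′ : ∀ x → Box N x → Bdry N x → curryΩ x ≈Ω ∗
      boundary′ x _ dx with box? N x | bdry? N x
      ... | yes _ | no ¬dx = contradiction dx ¬dx
      ... | yes _ | yes _ = ΩM.≈-refl {∗}
      ... | no _ | _ = ΩM.≈-refl {∗}

      outside′ : ∀ x → ¬ Box N x → curryΩ x ≈Ω ∗
      outside′ x ∉x with box? N x | bdry? N x
      ... | yes bx | _ = contradiction bx ∉x
      ... | no _ | _ = ΩM.≈-refl {∗}

  module _ {n N : ℕ} {g g′ : Vec ℕ (suc n) → V G} (gm : GM.BoxMap N g) (gm′ : GM.BoxMap N g′) where

    curryΩ-cong : (∀ z → g z ≡ g′ z) → ∀ x → curryΩ g gm x ≈Ω curryΩ g′ gm′ x
    curryΩ-cong g≡g′ x with box? N x | bdry? N x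
    ... | yes _ | no _ = refl , λ y _ → g≡g′ (x ∷ʳ y)
    ... | yes _ | yes _ = ΩM.≈-refl {∗}
    ... | no _ | _ = ΩM.≈-refl {∗}

    curryΩ-adj : (∀ z → EqAdj G (g z) (g′ z)) → ∀ x → curryΩ g gm x ≃Ω curryΩ g′ gm′ x
    curryΩ-adj g≃g′ x =
      loopAt⇒Ω≃ {curryΩ g gm x} {curryΩ g′ gm′ x} N (len-curryΩ g gm x) (len-curryΩ g′ gm′ x) λ y _ →
        EqAdj-resp (sym (loopAt-curryΩ g gm x y)) (sym (loopAt-curryΩ g′ gm′ x y)) (g≃g′ (x ∷ʳ y))

  curryΩ-walk : ∀ {n N} {g g′ : Vec ℕ (suc n) → V G} → GM.BoxWalk N g g′ →
                (gm : GM.BoxMap N g) (gm′ : GM.BoxMap N g′) → ΩM.BoxWalk N (curryΩ g gm) (curryΩ g′ gm′)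
  curryΩ-walk (GM.stay _ g≡g′) gm gm′ = ΩM.stay (curryΩ-boxMap _ gm) (curryΩ-cong gm gm′ g≡g′)
  curryΩ-walk (GM.move _ g≃g₁ w) gm gm′ =
    ΩM.move (curryΩ-boxMap _ gm) (curryΩ-adj gm (GM.walk-start w) g≃g₁) (curryΩ-walk w (GM.walk-start w) gm′)

  -- Lengthening a loop by a constant tail is a single edge of ΩG.
  walk-to-curryΩ : ∀ {n N} {F : Vec ℕ n → LoopV G b} → ΩM.BoxMap N F → (∀ x → len (F x) ≤ N) →
                   (gm : GM.BoxMap N (uncurryΩ F)) → ΩM.BoxWalk N F (curryΩ (uncurryΩ F) gm)
  walk-to-curryΩ {N = N} {F} Fm len≤N gm =
    ΩM.move Fm F≃ (ΩM.stay (curryΩ-boxMap _ gm) (λ x → ΩM.≈-refl {curryΩ _ gm x}))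
    where
    F≃ : ∀ x → F x ≃Ω curryΩ (uncurryΩ F) gm x
    F≃ x = loopAt⇒Ω≃ {F x} {curryΩ _ gm x} N (len≤N x) (len-curryΩ _ gm x) λ y _ →
      inj₁ (sym (trans (loopAt-curryΩ _ gm x y) (uncurryΩ-∷ʳ F x y)))

module Representatives (G : Graph) (b : V G) where
  open LoopGraph G b
  open Currying G b

  uncurryHeight : ∀ {n} → LoopRep (Ω G b) ∗ n → ℕ
  uncurryHeight r = height r ⊔ lengthBound (height r) (ΩM.extRep r)

  module _ {n : ℕ} (r : LoopRep (Ω G b) ∗ n) where

    len≤uncurryHeight : ∀ x → len (ΩM.extRep r x) ≤ uncurryHeight r
    len≤uncurryHeight x = ≤-trans (len≤lengthBound (ΩM.extRep-boxMap r) x) (m≤n⊔m _ _)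

    extRep-boxMap-uncurryHeight : ΩM.BoxMap (uncurryHeight r) (ΩM.extRep r)
    extRep-boxMap-uncurryHeight = ΩM.boxMap-mono (m≤m⊔n _ _) (ΩM.extRep-boxMap r)

    uncurryRep-boxMap : GM.BoxMap (uncurryHeight r) (uncurryΩ (ΩM.extRep r))
    uncurryRep-boxMap = uncurryΩ-boxMap extRep-boxMap-uncurryHeight len≤uncurryHeight

  uncurryRep : ∀ {n} → LoopRep (Ω G b) ∗ n → LoopRep (toR G) b (suc n)
  uncurryRep r = GM.toLoopRep (uncurryRep-boxMap r)

  uncurryRep-cong : ∀ {n} (r s : LoopRep (Ω G b) ∗ n) →
                    Equiv (Ω G b) ∗ (raw r) (raw s) → Equiv (toR G) b (raw (uncurryRep r)) (raw (uncurryRep s))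
  uncurryRep-cong r s r~s with ΩM.Equiv⇒walk r~s
  ... | _ , _ , _ , w = GM.boxWalk⇒Equiv (uncurryRep-boxMap r) (uncurryRep-boxMap s) (uncurryΩ-walk w)

  uncurryRep-injective : ∀ {n} (r s : LoopRep (Ω G b) ∗ n) →
                         Equiv (toR G) b (raw (uncurryRep r)) (raw (uncurryRep s)) → Equiv (Ω G b) ∗ (raw r) (raw s)
  uncurryRep-injective r s e with GM.Equiv⇒boxWalk (uncurryRep-boxMap r) (uncurryRep-boxMap s) e
  ... | N , r≤N , s≤N , w =
    ΩM.walk⇒Equiv
      (ΩM.walk-trans (via-curryΩ r r≤N)
        (ΩM.walk-trans (curryΩ-walk w (GM.boxMap-mono r≤N (uncurryRep-boxMap r))
                                      (GM.boxMap-mono s≤N (uncurryRep-boxMap s)))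
          (ΩM.walk-sym (via-curryΩ s s≤N))))
    where
    via-curryΩ : ∀ q → (q≤N : uncurryHeight q ≤ N) →
                 ΩM.BoxWalk N (ΩM.extRep q) (curryΩ _ (GM.boxMap-mono q≤N (uncurryRep-boxMap q)))
    via-curryΩ q q≤N = walk-to-curryΩ (ΩM.boxMap-mono q≤N (extRep-boxMap-uncurryHeight q))
                                      (λ x → ≤-trans (len≤uncurryHeight q x) q≤N) _

  curryRep : ∀ {n} → LoopRep (toR G) b (suc n) → LoopRep (Ω G b) ∗ n
  curryRep t = ΩM.toLoopRep (curryΩ-boxMap _ (GM.extRep-boxMap t))

  uncurryRep-onto : ∀ {n} (r : LoopRep (Ω G b) ∗ n) t → (∀ x → ΩM.extRep r x ≈Ω ΩM.extRep (curryRep t) x) →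
                    Equiv (toR G) b (raw (uncurryRep r)) (raw t)
  uncurryRep-onto r t r≈ = GM.extRep≈⇒Equiv (uncurryRep r) t λ z → begin
    GM.extRep (uncurryRep r) z           ≡⟨ GM.boxMap-ext (uncurryRep-boxMap r) z ⟩
    uncurryΩ (ΩM.extRep r) z             ≡⟨ uncurryΩ-cong {F = ΩM.extRep r} {ΩM.extRep (curryRep t)} r≈ z ⟩
    uncurryΩ (ΩM.extRep (curryRep t)) z  ≡⟨ uncurryΩ-cong {F = ΩM.extRep (curryRep t)} {slices}
                                                          (ΩM.boxMap-ext (curryΩ-boxMap _ gt)) z ⟩
    uncurryΩ slices z                    ≡⟨ uncurryΩ-curryΩ _ gt z ⟩
    GM.extRep t z                        ∎
    where
    open ≡-Reasoning
    gt : GM.BoxMap (height t) (GM.extRep t)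
    gt = GM.extRep-boxMap t
    slices : Vec ℕ _ → LoopV G b
    slices = curryΩ _ gt

  uncurryRep-curryRep : ∀ {n} (t : LoopRep (toR G) b (suc n)) →
                        Equiv (toR G) b (raw (uncurryRep (curryRep t))) (raw t)
  uncurryRep-curryRep t = uncurryRep-onto (curryRep t) t (λ x → ΩM.≈-refl {ΩM.extRep (curryRep t) x})

  pointRep : LoopV G b → LoopRep (Ω G b) ∗ 0
  pointRep u = record
    { height = 0 ; map = λ _ → u ; mhom = λ { [] [] _ _ c → contradiction c CAdj-[] } ; mbdry = λ { [] _ () } }

  Connected⇒Equiv : ∀ {u v} → Connected (Ω G b) u v → Equiv (Ω G b) ∗ (raw (pointRep u)) (raw (pointRep v))
  Connected⇒Equiv (k , w , w₀ , wₖ , step) =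
    0 , z≤n , z≤n , k , (λ _ t → w t) , adj′ , (λ { [] _ → w₀ }) , (λ { [] _ → wₖ }) , (λ { [] _ _ () })
    where
    adj′ : ∀ (x y : Vec ℕ 0) t s → Box 0 x → Box 0 y → t ≤ k → s ≤ k →
           (CAdj x y × t ≡ s) ⊎ (x ≡ y × PAdj t s) → w t ≃Ω w s
    adj′ [] [] _ _ _ _ _ _ (inj₁ (c , _)) = contradiction c CAdj-[]
    adj′ _ _ t _ _ _ _ t<k (inj₂ (refl , inj₁ refl)) = step t t<k
    adj′ _ _ _ s _ _ s<k _ (inj₂ (refl , inj₂ refl)) = Ω≃-sym {w s} {w (suc s)} (step s s<k)

  Equiv⇒Connected : ∀ {u v} → Equiv (Ω G b) ∗ (raw (pointRep u)) (raw (pointRep v)) → Connected (Ω G b) u v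
  Equiv⇒Connected (_ , _ , _ , l , H , hadj , h₀ , hₗ , _) =
    l , H [] , h₀ [] []ᵃ , hₗ [] []ᵃ ,
    λ t t<l → hadj [] [] t (suc t) []ᵃ []ᵃ (<⇒≤ t<l) t<l (inj₂ (refl , inj₁ refl))

  pathRep : LoopV G b → LoopRep (toR G) b 1
  pathRep u = uncurryRep (pointRep u)

  pathRep-bijective : IsBij0 (Ω G b) (toR G) b pathRep
  pathRep-bijective = record
    { well-defined = λ u v u~v → uncurryRep-cong (pointRep u) (pointRep v) (Connected⇒Equiv u~v)
    ; injective = λ u v e → Equiv⇒Connected (uncurryRep-injective (pointRep u) (pointRep v) e)
    ; surjective = λ t → map (curryRep t) [] ,
                         uncurryRep-onto (pointRep _) t (λ { [] → ΩM.≈-refl {map (curryRep t) []} }) }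

module Concatenation (G : Graph) (b : V G) where
  open LoopGraph G b
  open Currying G b
  open Representatives G b

  module _ {k hA hB mA : ℕ} {A B : Vec ℕ (suc k) → V G} (Am : GM.BoxMap hA A) (Bm : GM.BoxMap hB B)
           (A-beyond : ∀ {c} w → mA ≤ c → A (c ∷ w) ≡ b) where

    private
      PAdj-∸ : ∀ {D c c′} → ¬ c ≤ D → ¬ c′ ≤ D → PAdj c c′ → PAdj (c ∸ D) (c′ ∸ D)
      PAdj-∸ c≰D _ (inj₁ refl) = inj₁ (sym (+-∸-assoc 1 (<⇒≤ (≰⇒> c≰D))))
      PAdj-∸ _ c′≰D (inj₂ refl) = inj₂ (sym (+-∸-assoc 1 (<⇒≤ (≰⇒> c′≰D))))

      b≃B-at-1 : ∀ w → EqAdj G b (B (1 ∷ w))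
      b≃B-at-1 w = EqAdj-resp (GM.boxMap-at-0 Bm w) refl (GM.adj Bm (0 ∷ w) (1 ∷ w) (CAdj-head (inj₁ refl)))

      -- Across the seam, A is already at b and B is only one step away from b.
      seam : ∀ {D c c′} w → mA ≤ D → c ≤ D → ¬ c′ ≤ D → PAdj c c′ → EqAdj G (A (c ∷ w)) (B ((c′ ∸ D) ∷ w))
      seam {D} {c} w mA≤D c≤D c′≰D (inj₁ refl) with ≤-antisym c≤D (≤-pred (≰⇒> c′≰D))
      ... | refl = EqAdj-resp (sym (A-beyond w mA≤D)) (cong (λ i → B (i ∷ w)) (sym (m+n∸n≡m 1 D))) (b≃B-at-1 w)
      seam w mA≤D c≤D c′≰D (inj₂ refl) = contradiction (≤-trans (n≤1+n _) c≤D) c′≰D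

    glue-boxMap : ∀ {D N} → mA ≤ D → D + hB ≤ N → hA ≤ N → GM.BoxMap N (glue D A B)
    glue-boxMap {D} {N} mA≤D D+hB≤N hA≤N = record { adj = adj′ ; boundary = boundary′ ; outside = outside′ }
      where
      Am′ : GM.BoxMap N A
      Am′ = GM.boxMap-mono hA≤N Am
      Bm′ : GM.BoxMap N B
      Bm′ = GM.boxMap-mono (≤-trans (m≤n+m hB D) D+hB≤N) Bm
      hB≤N∸D : hB ≤ N ∸ D
      hB≤N∸D = subst (_≤ N ∸ D) (m+n∸m≡n D hB) (∸-monoˡ-≤ D D+hB≤N)

      adj′ : ∀ z z′ → CAdj z z′ → EqAdj G (glue D A B z) (glue D A B z′)
      adj′ (c ∷ w) (c′ ∷ w′) cd with CAdj-∷⁻ cd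
      ... | inj₂ (refl , w~w′) with c ≤? D
      ...   | yes _ = GM.adj Am _ _ (CAdj-tail w~w′)
      ...   | no _ = GM.adj Bm _ _ (CAdj-tail w~w′)
      adj′ (c ∷ w) (c′ ∷ w′) cd | inj₁ (refl , c~c′) with c ≤? D | c′ ≤? D
      ...   | yes _ | yes _ = GM.adj Am _ _ (CAdj-head c~c′)
      ...   | no c≰D | no c′≰D = GM.adj Bm _ _ (CAdj-head (PAdj-∸ c≰D c′≰D c~c′))
      ...   | yes c≤D | no c′≰D = seam w mA≤D c≤D c′≰D c~c′
      ...   | no c≰D | yes c′≤D = EqAdj-sym (seam w mA≤D c′≤D c≰D (PAdj-sym c~c′))

      boundary′ : ∀ z → Box N z → Bdry N z → glue D A B z ≡ b
      boundary′ (c ∷ w) bz@(c≤N ∷ᵃ bw) dz with c ≤? D | dz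
      ... | yes _ | _ = GM.boundary Am′ _ bz dz
      ... | no c≰D | here (inj₁ refl) = contradiction z≤n c≰D
      ... | no _ | here (inj₂ refl) = GM.boxMap-beyond Bm w hB≤N∸D
      ... | no _ | there dw = GM.boundary Bm′ _ (≤-trans (m∸n≤m c D) c≤N ∷ᵃ bw) (there dw)

      outside′ : ∀ z → ¬ Box N z → glue D A B z ≡ b
      outside′ (c ∷ w) ∉z with c ≤? D | box? N w
      ... | yes _ | _ = GM.outside Am′ _ ∉z
      ... | no _ | yes bw = GM.boxMap-beyond Bm w (≤-trans hB≤N∸D (∸-monoˡ-≤ D (<⇒≤ (≰⇒> (∉z ∘ (_∷ᵃ bw))))))
      ... | no _ | no ∉w = GM.outside Bm′ _ (λ { (_ ∷ᵃ bw) → ∉w bw })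

    -- Shifting the seam by one moves B one column to the right and puts b, adjacent to B at 1,
    -- into column D + 1.
    glue-step : ∀ {D} → mA ≤ D → ∀ z → EqAdj G (glue D A B z) (glue (suc D) A B z)
    glue-step {D} mA≤D (c ∷ w) with c ≤? D | c ≤? suc D
    ... | yes _ | yes _ = inj₁ refl
    ... | yes c≤D | no c≰1+D = contradiction (m≤n⇒m≤1+n c≤D) c≰1+D
    ... | no c≰D | yes c≤1+D with ≤-antisym c≤1+D (≰⇒> c≰D)
    ...   | refl = EqAdj-resp (cong (λ i → B (i ∷ w)) (sym (m+n∸n≡m 1 D))) (sym (A-beyond w (m≤n⇒m≤1+n mA≤D)))
                              (EqAdj-sym (b≃B-at-1 w))
    glue-step mA≤D (zero ∷ w) | no 0≰D | no _ = contradiction z≤n 0≰D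
    glue-step {D} mA≤D (suc c ∷ w) | no _ | no c≰D =
      GM.adj Bm _ _ (CAdj-head (inj₂ (sym (+-∸-assoc 1 (≤-pred (<⇒≤ (≰⇒> c≰D)))))))

    private
      glue-shift+ : ∀ d {D N} → mA ≤ D → D + d + hB ≤ N → hA ≤ N →
                    GM.BoxWalk N (glue D A B) (glue (D + d) A B)
      glue-shift+ zero {D} {N} mA≤D bound hA≤N =
        GM.stay (glue-boxMap mA≤D (subst (λ E → E + hB ≤ N) (+-identityʳ D) bound) hA≤N)
                (λ z → cong (λ E → glue E A B z) (sym (+-identityʳ D)))
      glue-shift+ (suc d) {D} {N} mA≤D bound hA≤N =
        GM.move (glue-boxMap mA≤D (≤-trans (+-monoˡ-≤ hB (m≤m+n D (suc d))) bound) hA≤N) (glue-step mA≤D)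
                (GM.walk-respʳ (glue-shift+ d (m≤n⇒m≤1+n mA≤D)
                                            (subst (λ E → E + hB ≤ N) (+-suc D d) bound) hA≤N)
                               (λ z → cong (λ E → glue E A B z) (sym (+-suc D d))))

    glue-shift : ∀ {D D′ N} → mA ≤ D → D ≤ D′ → D′ + hB ≤ N → hA ≤ N →
                 GM.BoxWalk N (glue D A B) (glue D′ A B)
    glue-shift {D} {D′} {N} mA≤D D≤D′ bound hA≤N =
      GM.walk-respʳ (glue-shift+ (D′ ∸ D) mA≤D (subst (λ E → E + hB ≤ N) (sym D+[D′∸D]≡D′) bound) hA≤N)
                    (λ z → cong (λ E → glue E A B z) D+[D′∸D]≡D′)
      where
      D+[D′∸D]≡D′ : D + (D′ ∸ D) ≡ D′
      D+[D′∸D]≡D′ = m+[n∸m]≡n D≤D′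

  uncurryΩ-glue : ∀ {k} D (F F′ : Vec ℕ (suc k) → LoopV G b) z →
                  uncurryΩ (glue D F F′) z ≡ glue D (uncurryΩ F) (uncurryΩ F′) z
  uncurryΩ-glue D F F′ (c ∷ w) with c ≤? D
  ... | yes _ = refl
  ... | no _ = refl

  uncurryRep-beyond : ∀ {k} (r : LoopRep (Ω G b) ∗ (suc k)) {c} w → height r ≤ c →
                      uncurryΩ (ΩM.extRep r) (c ∷ w) ≡ b
  uncurryRep-beyond r {c} w h≤c =
    loopAt-∗ {ΩM.extRep r (c ∷ init w)} (ΩM.boxMap-beyond (ΩM.extRep-boxMap r) (init w) h≤c) (last w)

  uncurryRep-homomorphic : ∀ {k} (r s t : LoopRep (Ω G b) ∗ (suc k)) →
    Equiv (Ω G b) ∗ (raw t) (mult (Ω G b) ∗ (raw r) (raw s)) →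
    Equiv (toR G) b (raw (uncurryRep t)) (mult (toR G) b (raw (uncurryRep r)) (raw (uncurryRep s)))
  uncurryRep-homomorphic {k} r s t t~rs with ΩM.Equiv⇒walk t~rs
  ... | N , _ , _ , w =
    GM.walk⇒Equiv (GM.walk-respˡ (GM.boxMap-ext (uncurryRep-boxMap t))
                    (GM.walk-respʳ (GM.walk-trans (GM.walk-mono (m≤m⊔n N₁ _) uncurried) shifted) (sym ∘ glued)))
    where
    M M′ : ℕ
    M = height r ⊔ height s
    M′ = uncurryHeight r ⊔ uncurryHeight s

    A B : Vec ℕ (suc (suc k)) → V G
    A = uncurryΩ (ΩM.extRep r)
    B = uncurryΩ (ΩM.extRep s)

    wΩ : ΩM.BoxWalk N (ΩM.extRep t) (glue M (ΩM.extRep r) (ΩM.extRep s))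
    wΩ = ΩM.walk-respʳ w (ΩM.≈-reflexive ∘ ΩM.ext-mult≡glue (height r) (height s) (map r) (map s))

    N₁ N′ : ℕ
    N₁ = N ⊔ walkLengthBound wΩ
    N′ = N₁ ⊔ (M′ + M′)

    uncurried : GM.BoxWalk N₁ (uncurryΩ (ΩM.extRep t)) (glue M A B)
    uncurried = GM.walk-respʳ (uncurryΩ-walk wΩ) (uncurryΩ-glue M (ΩM.extRep r) (ΩM.extRep s))

    shifted : GM.BoxWalk N′ (glue M A B) (glue M′ A B)
    shifted = glue-shift (uncurryRep-boxMap r) (uncurryRep-boxMap s) (uncurryRep-beyond r)
      (m≤m⊔n _ _)
      (⊔-mono-≤ (m≤m⊔n (height r) _) (m≤m⊔n (height s) _))
      (≤-trans (+-monoʳ-≤ M′ (m≤n⊔m (uncurryHeight r) _)) (m≤n⊔m N₁ _))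
      (≤-trans (m≤m⊔n (uncurryHeight r) _) (≤-trans (m≤m+n M′ M′) (m≤n⊔m N₁ _)))

    glued : ∀ z → ext (toR G) b (M′ + M′) (proj₂ (mult (toR G) b (uncurryHeight r , A) (uncurryHeight s , B))) z ≡
                  glue M′ A B z
    glued z = trans (GM.ext-mult≡glue (uncurryHeight r) (uncurryHeight s) A B z)
                    (glue-cong M′ (GM.boxMap-ext (uncurryRep-boxMap r)) (GM.boxMap-ext (uncurryRep-boxMap s)) z)

  uncurryRep-isGroupIso : ∀ k → IsGroupIso (Ω G b) ∗ (toR G) b k (suc k) uncurryRep
  uncurryRep-isGroupIso k = record
    { well-defined = uncurryRep-cong
    ; injective = uncurryRep-injective
    ; surjective = λ t → curryRep t , uncurryRep-curryRep t
    ; homomorphism = uncurryRep-homomorphic }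

module Naturality {G : Graph} {bG : V G} {H : Graph} {bH : V H} (ψ : BasedHom G bG H bH) where
  private
    module LG = LoopGraph G bG
    module LH = LoopGraph H bH
    module CG = Currying G bG
    module CH = Currying H bH
    module RG = Representatives G bG
    module RH = Representatives H bH
    ψ₀ : V G → V H
    ψ₀ = fun (hom ψ)

  extRep-Ωψ# : ∀ {n} (r : LoopRep (Ω G bG) LG.∗ n) x →
               LH.ΩM.extRep (Ωψ# ψ r) x LH.≈Ω Ωmap-v ψ (LG.ΩM.extRep r x)
  extRep-Ωψ# r x with box? (height r) x
  ... | yes _ = LH.ΩM.≈-refl {Ωmap-v ψ (map r x)}
  ... | no _ = LH.ΩM.≈-sym {Ωmap-v ψ LG.∗} {LH.∗} (Ωmap-based ψ)

  extRep-ψ# : ∀ {n} (t : LoopRep (toR G) bG n) x → LH.GM.extRep (ψ# ψ t) x ≡ ψ₀ (LG.GM.extRep t x)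
  extRep-ψ# t x with box? (height t) x
  ... | yes _ = refl
  ... | no _ = sym (based ψ)

  uncurryRep-natural : ∀ {n} (r : LoopRep (Ω G bG) LG.∗ n) →
    Equiv (toR H) bH (raw (RH.uncurryRep (Ωψ# ψ r))) (raw (ψ# ψ (RG.uncurryRep r)))
  uncurryRep-natural r = LH.GM.extRep≈⇒Equiv (RH.uncurryRep r′) (ψ# ψ (RG.uncurryRep r)) λ z → begin
    LH.GM.extRep (RH.uncurryRep r′) z            ≡⟨ LH.GM.boxMap-ext (RH.uncurryRep-boxMap r′) z ⟩
    CH.uncurryΩ (LH.ΩM.extRep r′) z              ≡⟨ CH.uncurryΩ-cong {F = LH.ΩM.extRep r′} {Ωψ-extRep}
                                                                     (extRep-Ωψ# r) z ⟩
    CH.uncurryΩ Ωψ-extRep z                      ≡⟨⟩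
    ψ₀ (CG.uncurryΩ (LG.ΩM.extRep r) z)          ≡⟨ cong ψ₀ (LG.GM.boxMap-ext (RG.uncurryRep-boxMap r) z) ⟨
    ψ₀ (LG.GM.extRep (RG.uncurryRep r) z)        ≡⟨ extRep-ψ# (RG.uncurryRep r) z ⟨
    LH.GM.extRep (ψ# ψ (RG.uncurryRep r)) z      ∎
    where
    open ≡-Reasoning
    r′ : LoopRep (Ω H bH) LH.∗ _
    r′ = Ωψ# ψ r
    Ωψ-extRep : Vec ℕ _ → LoopV H bH
    Ωψ-extRep = Ωmap-v ψ ∘ LG.ΩM.extRep r

proposition7p4 :
    Σ ((G : Graph) (b : V G) (k : ℕ) →
        LoopRep (Ω G b) (Ωbase G b) (suc k) → LoopRep (toR G) b (suc (suc k)))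
      (λ Φ →
        (∀ (G : Graph) (b : V G) (k : ℕ) →
           IsGroupIso (Ω G b) (Ωbase G b) (toR G) b k (suc k) (Φ G b k))
        × (∀ (G : Graph) (bG : V G) (H : Graph) (bH : V H)
             (ψ : BasedHom G bG H bH) (k : ℕ)
             (r : LoopRep (Ω G bG) (Ωbase G bG) (suc k)) →
             Equiv (toR H) bH (raw (Φ H bH k (Ωψ# ψ r))) (raw (ψ# ψ (Φ G bG k r)))))
    × (∀ (G : Graph) (b : V G) →
         Σ (LoopV G b → LoopRep (toR G) b 1) λ β → IsBij0 (Ω G b) (toR G) b β)
proposition7p4 =
  ( (λ G b _ → Representatives.uncurryRep G b)
  , (λ G b k → Concatenation.uncurryRep-isGroupIso G b k)
  , (λ _ _ _ _ ψ _ → Naturality.uncurryRep-natural ψ) )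
  , (λ G b → Representatives.pathRep G b , Representatives.pathRep-bijective G b)
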